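{- For every integer $l\ge4$, \[ N_{G^{dual +}_{D_{l}}}(t) = \frac{l-2}{2l-1}N_{G^{dual +}_{B_{l}}}(t) + \Big(\frac{l+1}{2l-1}-t\Big)N_{G^{dual +}_{B_{l-1}}}(t). \]
   Context: For a finite Coxeter type $P$ with Coxeter system $(W,S)$, set of reflections $T$, reflection length $\ell_T$, order $g\le_T h\iff \ell_T(g)+\ell_T(g^{ -1}h)=\ell_T(h)$, and bipartite Coxeter element $c$, the dual Artin monoid $G^{dual+}_P$ is the monoid generated by $T$ with relations $r\cdot s=(rsr^{ -1})\cdot r$ for all $r,s\in T$ with $rs\le_T c$; it is graded by word length $\deg$ and is a lattice for left divisibility. Its skew-growth function is $N_{G^{dual+}_P}(t)=\sum_{J\subseteq T}(-1)^{|J|}t^{\deg(\mathrm{lcm}(J))}$. It is known that $N_{G^{dual +}_{B_l}}(t)=\sum_{k=0}^{l} (-1)^{k}\binom {l}{k}\binom {l+k-1}{k}t^k$ ($l\ge2$) and $N_{G^{dual +}_{D_l}}(t)=\sum_{k=0}^{l} (-1)^{k} \big( \binom {l}{k}\binom {l+k-2}{k} + \binom {l-2}{k-2}\binom {l+k-3}{k}\big) t^k$ ($l\ge4$). -}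

module Defs where

open import Data.Nat using (ℕ; zero; suc; _∸_; _≤_) renaming (_+_ to _+ℕ_; _*_ to _*ℕ_)
open import Data.Nat.Combinatorics using (_C_)
open import Data.Integer using (ℤ; +_)
open import Data.Rational using (ℚ; 0ℚ; 1ℚ; _+_; _*_; _-_; -_; _/_)

ℕ→ℚ : ℕ → ℚ
ℕ→ℚ n = (+ n) / 1

_^ℚ_ : ℚ → ℕ → ℚ
x ^ℚ zero    = 1ℚ
x ^ℚ (suc k) = x * (x ^ℚ k)

sgn : ℕ → ℚ
sgn zero    = 1ℚ
sgn (suc k) = - sgn k

Σ≤ : ℕ → (ℕ → ℚ) → ℚ
Σ≤ zero    f = f 0
Σ≤ (suc n) f = Σ≤ n f + f (suc n)

binomShift : ℕ → ℕ → ℕ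
binomShift l zero          = 0
binomShift l (suc zero)    = 0
binomShift l (suc (suc j)) = (l ∸ 2) C j

-- Skew-growth function of the dual Artin monoid of type B_l, evaluated at t
-- (explicit formula, valid for l ≥ 2):
-- N_B l (t) = Σ_{k=0}^{l} (-1)^k binom(l,k) binom(l+k-1,k) t^k
N-B : ℕ → ℚ → ℚ
N-B l t = Σ≤ l (λ k → sgn k * ℕ→ℚ ((l C k) *ℕ ((l +ℕ k ∸ 1) C k)) * (t ^ℚ k))

-- Skew-growth function of the dual Artin monoid of type D_l, evaluated at t
-- (explicit formula, valid for l ≥ 4):
-- N_D l (t) = Σ_{k=0}^{l} (-1)^k (binom(l,k) binom(l+k-2,k) + binom(l-2,k-2) binom(l+k-3,k)) t^k
N-D : ℕ → ℚ → ℚ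
N-D l t = Σ≤ l (λ k → sgn k
  * ℕ→ℚ ((l C k) *ℕ ((l +ℕ k ∸ 2) C k) +ℕ binomShift l k *ℕ ((l +ℕ k ∸ 3) C k))
  * (t ^ℚ k))

-- the rational number a / (2l - 1), written with denominator suc (2l - 2) = 2l - 1 for l ≥ 1
over2l-1 : ℕ → ℕ → ℚ
over2l-1 a l = (+ a) / suc (2 *ℕ l ∸ 2)

{-# OPTIONS --safe #-}
-- Multiplying by 2l − 1 and comparing coefficients of t^k, the identity becomes
--   (2l − 1) d_l(k) = (l − 2) b_l(k) + (l + 1) b_{l−1}(k) + (2l − 1) b_{l−1}(k − 1)
-- for the coefficients b of N_B and d of N_D. For k ≥ 2 the absorption identities make each of
-- the five products of binomial coefficients occurring here a rational multiple of
-- C(l−2, k−2) C(l+k−3, k−1); clearing the common denominator (k − 1) k² (l − 1) leaves a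
-- polynomial identity in k and l.
module Submission where

open import Defs
open import Data.Nat using (ℕ; zero; suc; _≤_; _∸_; s≤s)
open import Relation.Binary.PropositionalEquality using (_≡_; refl; cong; cong₂; trans; sym; module ≡-Reasoning)

shift : (ℕ → ℕ) → ℕ → ℕ
shift c zero    = 0
shift c (suc k) = c k

module BinomialIdentities where

  open import Data.Nat using (_+_; _*_; z≤n; s≤s⁻¹)
  open import Data.Nat.Properties
    using (+-cancelˡ-≡; *-cancelˡ-≡; *-zeroʳ; *-identityˡ; *-identityʳ; *-assoc; *-distribˡ-+; *-distribʳ-+;
           +-assoc; +-suc; +-comm; *-commutativeSemigroup; m≤n⇒∃[o]m+o≡n)
  open import Algebra.Properties.CommutativeSemigroup *-commutativeSemigroup using (xy∙z≈y∙xz; x∙yz≈y∙xz)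
  open import Data.Nat.Combinatorics using (_C_; nC1≡n; k>n⇒nCk≡0; nCk+nC[k+1]≡[n+1]C[k+1])
  open import Data.Nat.Tactic.RingSolver using (solve-∀; solve)
  open import Data.List using ([]; _∷_)
  open import Data.Product using (_,_)
  open ≡-Reasoning

  [k+1]*[n+1]C[k+1]≡[n+1]*nCk : ∀ n k → suc k * (suc n C suc k) ≡ suc n * (n C k)
  [k+1]*[n+1]C[k+1]≡[n+1]*nCk zero    zero    = refl
  [k+1]*[n+1]C[k+1]≡[n+1]*nCk zero    (suc k) =
    trans (cong (suc (suc k) *_) (k>n⇒nCk≡0 {1} {suc (suc k)} (s≤s (s≤s z≤n)))) (*-zeroʳ (suc (suc k)))
  [k+1]*[n+1]C[k+1]≡[n+1]*nCk (suc n) zero    =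
    trans (*-identityˡ _) (trans (nC1≡n (suc (suc n))) (sym (*-identityʳ (suc (suc n)))))
  [k+1]*[n+1]C[k+1]≡[n+1]*nCk (suc n) (suc k) = begin
    suc (suc k) * (suc (suc n) C suc (suc k))
      ≡⟨ cong (suc (suc k) *_) (sym (nCk+nC[k+1]≡[n+1]C[k+1] (suc n) (suc k))) ⟩
    suc (suc k) * (A + B)
      ≡⟨ *-distribˡ-+ (suc (suc k)) A B ⟩
    (A + suc k * A) + suc (suc k) * B
      ≡⟨ +-assoc A (suc k * A) (suc (suc k) * B) ⟩
    A + (suc k * A + suc (suc k) * B)
      ≡⟨ cong₂ (λ x y → A + (x + y)) ([k+1]*[n+1]C[k+1]≡[n+1]*nCk n k) ([k+1]*[n+1]C[k+1]≡[n+1]*nCk n (suc k)) ⟩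
    A + (suc n * (n C k) + suc n * (n C suc k))
      ≡⟨ cong (A +_) (sym (*-distribˡ-+ (suc n) (n C k) (n C suc k))) ⟩
    A + suc n * (n C k + n C suc k)
      ≡⟨ cong (λ x → A + suc n * x) (nCk+nC[k+1]≡[n+1]C[k+1] n k) ⟩
    suc (suc n) * A ∎
    where
    A = suc n C suc k
    B = suc n C suc (suc k)

  [k+1]*[k+n]C[k+1]≡n*[k+n]Ck : ∀ k n → suc k * ((k + n) C suc k) ≡ n * ((k + n) C k)
  [k+1]*[k+n]C[k+1]≡n*[k+n]Ck k n = +-cancelˡ-≡ (suc k * A) _ _ (begin
    suc k * A + suc k * B          ≡⟨ *-distribˡ-+ (suc k) A B ⟨
    suc k * (A + B)                ≡⟨ cong (suc k *_) (nCk+nC[k+1]≡[n+1]C[k+1] (k + n) k) ⟩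
    suc k * (suc (k + n) C suc k)  ≡⟨ [k+1]*[n+1]C[k+1]≡[n+1]*nCk (k + n) k ⟩
    (suc k + n) * A                ≡⟨ *-distribʳ-+ A (suc k) n ⟩
    suc k * A + n * A              ∎)
    where
    A = (k + n) C k
    B = (k + n) C suc k

  [k+n+1]*[k+n]Ck≡[n+1]*[k+n+1]Ck : ∀ k n → suc (k + n) * ((k + n) C k) ≡ suc n * (suc (k + n) C k)
  [k+n+1]*[k+n]Ck≡[n+1]*[k+n+1]Ck k n = begin
    suc (k + n) * ((k + n) C k)      ≡⟨ [k+1]*[n+1]C[k+1]≡[n+1]*nCk (k + n) k ⟨
    suc k * (suc (k + n) C suc k)    ≡⟨ cong (λ x → suc k * (x C suc k)) (+-suc k n) ⟨
    suc k * ((k + suc n) C suc k)    ≡⟨ [k+1]*[k+n]C[k+1]≡n*[k+n]Ck k (suc n) ⟩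
    suc n * ((k + suc n) C k)        ≡⟨ cong (λ x → suc n * (x C k)) (+-suc k n) ⟩
    suc n * (suc (k + n) C k)        ∎

  -- A record rather than the bare equation, so that unification can recover u, x, p and y
  -- (it cannot invert ℕ multiplication).
  record Proportional (u x p y : ℕ) : Set where
    constructor proportional
    field
      u*x≡p*y : u * x ≡ p * y

  proportion-trans : ∀ {u v p s x y z} → Proportional u x p y → Proportional v y s z → Proportional (u * v) x (p * s) z
  proportion-trans {u} {v} {p} {s} {x} {y} {z} (proportional ux≡py) (proportional vy≡sz) = proportional (begin
    (u * v) * x  ≡⟨ xy∙z≈y∙xz u v x ⟩
    v * (u * x)  ≡⟨ cong (v *_) ux≡py ⟩
    v * (p * y)  ≡⟨ x∙yz≈y∙xz v p y ⟩
    p * (v * y)  ≡⟨ cong (p *_) vy≡sz ⟩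
    p * (s * z)  ≡⟨ *-assoc p s z ⟨
    (p * s) * z  ∎)

  proportion-scale : ∀ w {u p x y} → Proportional u x p y → Proportional (w * u) x (w * p) y
  proportion-scale w {u} {p} {x} {y} (proportional ux≡py) = proportional (begin
    (w * u) * x  ≡⟨ *-assoc w u x ⟩
    w * (u * x)  ≡⟨ cong (w *_) ux≡py ⟩
    w * (p * y)  ≡⟨ *-assoc w p y ⟨
    (w * p) * y  ∎)

  *-rescale₂ : ∀ u v d x₁ y₁ x₂ y₂ →
    (u * v) * (d * (x₁ * y₁ + x₂ * y₂)) ≡ d * ((u * x₁) * (v * y₁) + (u * x₂) * (v * y₂))
  *-rescale₂ = solve-∀

  *-rescale₃ : ∀ u v d₁ d₂ d₃ x₁ y₁ x₂ y₂ x₃ y₃ →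
    (u * v) * (d₁ * (x₁ * y₁) + d₂ * (x₂ * y₂) + d₃ * (x₃ * y₃))
    ≡ d₁ * ((u * x₁) * (v * y₁)) + d₂ * ((u * x₂) * (v * y₂)) + d₃ * ((u * x₃) * (v * y₃))
  *-rescale₃ = solve-∀

  cleared-coeff-identity : ∀ j r {a c x′ x₀ x₁ y₁ y₂ y₃} →
    let q = j + r ; n = suc (j + q) ; d = 3 + 2 * q in
    x₁ ≡ (suc (suc q) * suc q) * a → x₀ ≡ (r * suc q) * a → x′ ≡ (suc (suc j) * suc q) * a →
    y₁ ≡ (suc q * q) * c → y₂ ≡ (suc q * suc n) * c → y₃ ≡ (suc (suc n) * suc n) * c →
    d * (x₁ * y₂ + ((suc (suc j) * suc j) * a) * y₁)
    ≡ q * (x₁ * y₃) + (3 + q) * (x₀ * y₂) + d * (x′ * ((suc q * suc (suc j)) * c))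
  cleared-coeff-identity j r {a} {c} refl refl refl refl refl refl = solve (j ∷ r ∷ a ∷ c ∷ [])

  proportional-coeff-identity : ∀ j r {a c X′ X₀ X₁ Y₁ Y₂ Y₃ : ℕ} →
    let q = j + r ; n = suc (j + q) in
    Proportional (suc j) X′ (suc q) a →
    Proportional (suc (suc j)) X₁ (suc (suc q)) X′ →
    Proportional (suc (suc j)) X₀ r X′ →
    Proportional (suc (suc j)) Y₁ q c →
    Proportional (suc (suc j)) Y₂ (suc n) c →
    Proportional (suc q) Y₃ (suc (suc n)) Y₂ →
    (3 + 2 * q) * (X₁ * Y₂ + a * Y₁) ≡ q * (X₁ * Y₃) + (3 + q) * (X₀ * Y₂) + (3 + 2 * q) * (X′ * c)
  proportional-coeff-identity j r {a} {c} {X′} {X₀} {X₁} {Y₁} {Y₂} {Y₃}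
                              X′∝a X₁∝X′ X₀∝X′ Y₁∝c Y₂∝c Y₃∝Y₂ =
    *-cancelˡ-≡ _ _ (uX * uY) (begin
      (uX * uY) * (d * (X₁ * Y₂ + a * Y₁))
        ≡⟨ *-rescale₂ uX uY d X₁ Y₂ a Y₁ ⟩
      d * ((uX * X₁) * (uY * Y₂) + (uX * a) * (uY * Y₁))
        ≡⟨ cleared-coeff-identity j r (u*x≡p*y uX*X₁) (u*x≡p*y uX*X₀) (u*x≡p*y uX*X′)
                                     (u*x≡p*y uY*Y₁) (u*x≡p*y uY*Y₂) (u*x≡p*y uY*Y₃) ⟩
      q * ((uX * X₁) * (uY * Y₃)) + (3 + q) * ((uX * X₀) * (uY * Y₂)) + d * ((uX * X′) * (uY * c))
        ≡⟨ *-rescale₃ uX uY q (3 + q) d X₁ Y₃ X₀ Y₂ X′ c ⟨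
      (uX * uY) * (q * (X₁ * Y₃) + (3 + q) * (X₀ * Y₂) + d * (X′ * c)) ∎)
    where
    open Proportional
    q = j + r
    n = suc (j + q)
    d = 3 + 2 * q
    uX = suc (suc j) * suc j
    uY = suc q * suc (suc j)
    uX*X₁ : Proportional uX X₁ (suc (suc q) * suc q) a
    uX*X₁ = proportion-trans X₁∝X′ X′∝a
    uX*X₀ : Proportional uX X₀ (r * suc q) a
    uX*X₀ = proportion-trans X₀∝X′ X′∝a
    uX*X′ : Proportional uX X′ (suc (suc j) * suc q) a
    uX*X′ = proportion-scale (suc (suc j)) X′∝a
    uY*Y₁ : Proportional uY Y₁ (suc q * q) c
    uY*Y₁ = proportion-scale (suc q) Y₁∝c
    uY*Y₂ : Proportional uY Y₂ (suc q * suc n) c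
    uY*Y₂ = proportion-scale (suc q) Y₂∝c
    uY*Y₃ : Proportional uY Y₃ (suc (suc n) * suc n) c
    uY*Y₃ = proportion-trans Y₃∝Y₂ Y₂∝c

  B-coeff : ℕ → ℕ → ℕ
  B-coeff l k = (l C k) * ((l + k ∸ 1) C k)

  D-coeff : ℕ → ℕ → ℕ
  D-coeff l k = (l C k) * ((l + k ∸ 2) C k) + binomShift l k * ((l + k ∸ 3) C k)

  D-coeff-recurrence : ∀ m k → k ≤ 2 + m →
    (3 + 2 * m) * D-coeff (2 + m) k
    ≡ m * B-coeff (2 + m) k + (3 + m) * B-coeff (1 + m) k + (3 + 2 * m) * shift (B-coeff (1 + m)) k
  D-coeff-recurrence m zero _ = solve (m ∷ [])
  D-coeff-recurrence m (suc zero) _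
    rewrite nC1≡n (2 + m) | nC1≡n (1 + m) | nC1≡n (m + 1) | nC1≡n (suc (m + 1)) = solve (m ∷ [])
  -- With l = 2 + q, k = 2 + j and q = j + r, the rewrites turn the upper indices q + (2 + j) into 2 + (j + q).
  D-coeff-recurrence m (suc (suc j)) k≤l with m≤n⇒∃[o]m+o≡n (s≤s⁻¹ (s≤s⁻¹ k≤l))
  ... | r , refl rewrite +-suc (j + r) (suc j) | +-comm (j + r) (suc j) =
    proportional-coeff-identity j r
      {a = q C j} {c = suc (j + q) C suc j}
      {X′ = suc q C suc j} {X₀ = suc q C suc (suc j)} {X₁ = suc (suc q) C suc (suc j)}
      {Y₁ = suc (j + q) C suc (suc j)} {Y₂ = suc (suc (j + q)) C suc (suc j)} {Y₃ = suc (suc (suc (j + q))) C suc (suc j)}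
      (proportional ([k+1]*[n+1]C[k+1]≡[n+1]*nCk q j))
      (proportional ([k+1]*[n+1]C[k+1]≡[n+1]*nCk (suc q) (suc j)))
      (proportional ([k+1]*[k+n]C[k+1]≡n*[k+n]Ck (suc j) r))
      (proportional ([k+1]*[k+n]C[k+1]≡n*[k+n]Ck (suc j) q))
      (proportional ([k+1]*[n+1]C[k+1]≡[n+1]*nCk (suc (j + q)) (suc j)))
      (proportional (sym ([k+n+1]*[k+n]Ck≡[n+1]*[k+n+1]Ck (suc (suc j)) q)))
    where q = j + r

module AlternatingSums where

  open import Data.Nat as ℕ using (z≤n)
  import Data.Nat.Properties as ℕ
  open import Data.Integer as ℤ using (+_)
  import Data.Integer.Properties as ℤ
  open import Data.Rational using (ℚ; 0ℚ; 1ℚ; _+_; _*_; -_; _/_; toℚᵘ)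
  open import Data.Rational.Properties
    using (toℚᵘ-injective; toℚᵘ-fromℚᵘ; toℚᵘ-homo-+; toℚᵘ-homo-*; +-assoc; +-identityˡ; +-identityʳ;
           *-assoc; *-comm; *-identityˡ; *-zeroˡ; *-zeroʳ; *-distribˡ-+; *-distribʳ-+; +-0-commutativeMonoid)
  open import Data.Rational.Unnormalised as ℚᵘ using (mkℚᵘ; *≡*) renaming (_+_ to _+ᵘ_; _*_ to _*ᵘ_)
  open import Data.Rational.Unnormalised.Properties using (+-cong; *-cong; module ≃-Reasoning)
  open import Data.Rational.Solver using (module +-*-Solver)
  open import Algebra.Bundles using (CommutativeMonoid)
  open import Algebra.Properties.CommutativeSemigroup (CommutativeMonoid.commutativeSemigroup +-0-commutativeMonoid)
    using () renaming (interchange to +-interchange)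

  toℚᵘ-/ : ∀ i d → toℚᵘ (i / suc d) ℚᵘ.≃ mkℚᵘ i d
  toℚᵘ-/ i d = toℚᵘ-fromℚᵘ (mkℚᵘ i d)

  ℕ→ℚ-homo-+ : ∀ m n → ℕ→ℚ (m ℕ.+ n) ≡ ℕ→ℚ m + ℕ→ℚ n
  ℕ→ℚ-homo-+ m n = toℚᵘ-injective (begin
    toℚᵘ (ℕ→ℚ (m ℕ.+ n))           ≈⟨ toℚᵘ-/ (+ (m ℕ.+ n)) 0 ⟩
    mkℚᵘ (+ (m ℕ.+ n)) 0           ≈⟨ *≡* (cong (ℤ._* + 1) (trans (ℤ.pos-+ m n)
                                        (sym (cong₂ ℤ._+_ (ℤ.*-identityʳ (+ m)) (ℤ.*-identityʳ (+ n)))))) ⟩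
    mkℚᵘ (+ m) 0 +ᵘ mkℚᵘ (+ n) 0   ≈⟨ +-cong (toℚᵘ-/ (+ m) 0) (toℚᵘ-/ (+ n) 0) ⟨
    toℚᵘ (ℕ→ℚ m) +ᵘ toℚᵘ (ℕ→ℚ n)   ≈⟨ toℚᵘ-homo-+ (ℕ→ℚ m) (ℕ→ℚ n) ⟨
    toℚᵘ (ℕ→ℚ m + ℕ→ℚ n)          ∎)
    where open ≃-Reasoning

  ℕ→ℚ-homo-* : ∀ m n → ℕ→ℚ (m ℕ.* n) ≡ ℕ→ℚ m * ℕ→ℚ n
  ℕ→ℚ-homo-* m n = toℚᵘ-injective (begin
    toℚᵘ (ℕ→ℚ (m ℕ.* n))           ≈⟨ toℚᵘ-/ (+ (m ℕ.* n)) 0 ⟩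
    mkℚᵘ (+ (m ℕ.* n)) 0           ≈⟨ *≡* (cong (ℤ._* + 1) (ℤ.pos-* m n)) ⟩
    mkℚᵘ (+ m) 0 *ᵘ mkℚᵘ (+ n) 0   ≈⟨ *-cong (toℚᵘ-/ (+ m) 0) (toℚᵘ-/ (+ n) 0) ⟨
    toℚᵘ (ℕ→ℚ m) *ᵘ toℚᵘ (ℕ→ℚ n)   ≈⟨ toℚᵘ-homo-* (ℕ→ℚ m) (ℕ→ℚ n) ⟨
    toℚᵘ (ℕ→ℚ m * ℕ→ℚ n)          ∎)
    where open ≃-Reasoning

  ℕ→ℚ-*-/ : ∀ a d → ℕ→ℚ (suc d) * ((+ a) / suc d) ≡ ℕ→ℚ a
  ℕ→ℚ-*-/ a d = toℚᵘ-injective (begin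
    toℚᵘ (ℕ→ℚ (suc d) * ((+ a) / suc d))        ≈⟨ toℚᵘ-homo-* (ℕ→ℚ (suc d)) ((+ a) / suc d) ⟩
    toℚᵘ (ℕ→ℚ (suc d)) *ᵘ toℚᵘ ((+ a) / suc d)  ≈⟨ *-cong (toℚᵘ-/ (+ suc d) 0) (toℚᵘ-/ (+ a) d) ⟩
    mkℚᵘ (+ suc d) 0 *ᵘ mkℚᵘ (+ a) d           ≈⟨ *≡* eq ⟩
    mkℚᵘ (+ a) 0                               ≈⟨ toℚᵘ-/ (+ a) 0 ⟨
    toℚᵘ (ℕ→ℚ a)                               ∎)
    where
    open ≃-Reasoning
    eq : (+ suc d ℤ.* + a) ℤ.* + 1 ≡ + a ℤ.* + (1 ℕ.* suc d)
    eq = trans (ℤ.*-identityʳ _) (trans (ℤ.*-comm (+ suc d) (+ a))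
           (cong (λ n → + a ℤ.* + n) (sym (ℕ.*-identityˡ (suc d)))))

  ℕ→ℚ-suc-cancelˡ : ∀ d {p q} → ℕ→ℚ (suc d) * p ≡ ℕ→ℚ (suc d) * q → p ≡ q
  ℕ→ℚ-suc-cancelˡ d {p} {q} δp≡δq = begin
    p             ≡⟨ *-identityˡ p ⟨
    1ℚ * p        ≡⟨ cong (_* p) ι*δ≡1 ⟨
    (ι * δ) * p   ≡⟨ *-assoc ι δ p ⟩
    ι * (δ * p)   ≡⟨ cong (ι *_) δp≡δq ⟩
    ι * (δ * q)   ≡⟨ *-assoc ι δ q ⟨
    (ι * δ) * q   ≡⟨ cong (_* q) ι*δ≡1 ⟩
    1ℚ * q        ≡⟨ *-identityˡ q ⟩
    q             ∎
    where
    open ≡-Reasoning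
    δ = ℕ→ℚ (suc d)
    ι = (+ 1) / suc d
    ι*δ≡1 : ι * δ ≡ 1ℚ
    ι*δ≡1 = trans (*-comm ι δ) (ℕ→ℚ-*-/ 1 d)

  Σ≤-cong : ∀ n {f g : ℕ → ℚ} → (∀ k → k ≤ n → f k ≡ g k) → Σ≤ n f ≡ Σ≤ n g
  Σ≤-cong zero    f≗g = f≗g 0 z≤n
  Σ≤-cong (suc n) f≗g =
    cong₂ _+_ (Σ≤-cong n (λ k k≤n → f≗g k (ℕ.m≤n⇒m≤1+n k≤n))) (f≗g (suc n) ℕ.≤-refl)

  Σ≤-+ : ∀ n (f g : ℕ → ℚ) → Σ≤ n (λ k → f k + g k) ≡ Σ≤ n f + Σ≤ n g
  Σ≤-+ zero    f g = refl
  Σ≤-+ (suc n) f g = begin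
    Σ≤ n (λ k → f k + g k) + (f (suc n) + g (suc n))
      ≡⟨ cong (_+ (f (suc n) + g (suc n))) (Σ≤-+ n f g) ⟩
    (Σ≤ n f + Σ≤ n g) + (f (suc n) + g (suc n))
      ≡⟨ +-interchange (Σ≤ n f) (Σ≤ n g) (f (suc n)) (g (suc n)) ⟩
    (Σ≤ n f + f (suc n)) + (Σ≤ n g + g (suc n)) ∎
    where open ≡-Reasoning

  Σ≤-*ˡ : ∀ n c (f : ℕ → ℚ) → Σ≤ n (λ k → c * f k) ≡ c * Σ≤ n f
  Σ≤-*ˡ zero    c f = refl
  Σ≤-*ˡ (suc n) c f = trans (cong (_+ c * f (suc n)) (Σ≤-*ˡ n c f)) (sym (*-distribˡ-+ c (Σ≤ n f) (f (suc n))))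

  Σ≤-suc : ∀ n (f : ℕ → ℚ) → Σ≤ (suc n) f ≡ f 0 + Σ≤ n (λ k → f (suc k))
  Σ≤-suc zero    f = refl
  Σ≤-suc (suc n) f = trans (cong (_+ f (suc (suc n))) (Σ≤-suc n f)) (+-assoc (f 0) _ _)

  alternatingPoly : ℕ → (ℕ → ℕ) → ℚ → ℚ
  alternatingPoly n c t = Σ≤ n (λ k → sgn k * ℕ→ℚ (c k) * (t ^ℚ k))

  alternatingPoly-cong : ∀ n {c e} t → (∀ k → k ≤ n → c k ≡ e k) → alternatingPoly n c t ≡ alternatingPoly n e t
  alternatingPoly-cong n t c≗e = Σ≤-cong n (λ k k≤n → cong (λ x → sgn k * ℕ→ℚ x * (t ^ℚ k)) (c≗e k k≤n))

  alternatingPoly-+ : ∀ n c e t →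
    alternatingPoly n (λ k → c k ℕ.+ e k) t ≡ alternatingPoly n c t + alternatingPoly n e t
  alternatingPoly-+ n c e t = trans (Σ≤-cong n (λ k _ → term k)) (Σ≤-+ n _ _)
    where
    term : ∀ k → sgn k * ℕ→ℚ (c k ℕ.+ e k) * (t ^ℚ k)
               ≡ sgn k * ℕ→ℚ (c k) * (t ^ℚ k) + sgn k * ℕ→ℚ (e k) * (t ^ℚ k)
    term k = begin
      sgn k * ℕ→ℚ (c k ℕ.+ e k) * (t ^ℚ k)
        ≡⟨ cong (λ x → sgn k * x * (t ^ℚ k)) (ℕ→ℚ-homo-+ (c k) (e k)) ⟩
      sgn k * (C + E) * (t ^ℚ k)
        ≡⟨ cong (_* (t ^ℚ k)) (*-distribˡ-+ (sgn k) C E) ⟩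
      (sgn k * C + sgn k * E) * (t ^ℚ k)
        ≡⟨ *-distribʳ-+ (t ^ℚ k) (sgn k * C) (sgn k * E) ⟩
      sgn k * C * (t ^ℚ k) + sgn k * E * (t ^ℚ k) ∎
      where
      open ≡-Reasoning
      C = ℕ→ℚ (c k)
      E = ℕ→ℚ (e k)

  alternatingPoly-* : ∀ n a c t → alternatingPoly n (λ k → a ℕ.* c k) t ≡ ℕ→ℚ a * alternatingPoly n c t
  alternatingPoly-* n a c t = trans (Σ≤-cong n (λ k _ → term k)) (Σ≤-*ˡ n (ℕ→ℚ a) _)
    where
    open +-*-Solver
    term : ∀ k → sgn k * ℕ→ℚ (a ℕ.* c k) * (t ^ℚ k) ≡ ℕ→ℚ a * (sgn k * ℕ→ℚ (c k) * (t ^ℚ k))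
    term k = trans (cong (λ x → sgn k * x * (t ^ℚ k)) (ℕ→ℚ-homo-* a (c k)))
      (solve 4 (λ s A C T → s :* (A :* C) :* T := A :* (s :* C :* T)) refl (sgn k) (ℕ→ℚ a) (ℕ→ℚ (c k)) (t ^ℚ k))

  alternatingPoly-shift : ∀ n c t → alternatingPoly (suc n) (shift c) t ≡ - t * alternatingPoly n c t
  alternatingPoly-shift n c t = begin
    alternatingPoly (suc n) (shift c) t                                ≡⟨ Σ≤-suc n _ ⟩
    0ℚ + Σ≤ n (λ k → - sgn k * ℕ→ℚ (c k) * (t * (t ^ℚ k)))             ≡⟨ +-identityˡ _ ⟩
    Σ≤ n (λ k → - sgn k * ℕ→ℚ (c k) * (t * (t ^ℚ k)))                  ≡⟨ Σ≤-cong n (λ k _ → term k) ⟩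
    Σ≤ n (λ k → - t * (sgn k * ℕ→ℚ (c k) * (t ^ℚ k)))                  ≡⟨ Σ≤-*ˡ n (- t) _ ⟩
    - t * alternatingPoly n c t                                        ∎
    where
    open ≡-Reasoning
    open +-*-Solver
    term : ∀ k → - sgn k * ℕ→ℚ (c k) * (t * (t ^ℚ k)) ≡ - t * (sgn k * ℕ→ℚ (c k) * (t ^ℚ k))
    term k = solve 4 (λ s C x T → :- s :* C :* (x :* T) := :- x :* (s :* C :* T)) refl (sgn k) (ℕ→ℚ (c k)) t (t ^ℚ k)

  alternatingPoly-drop-top : ∀ n c t → c (suc n) ≡ 0 → alternatingPoly (suc n) c t ≡ alternatingPoly n c t
  alternatingPoly-drop-top n c t c₁₊ₙ≡0 = trans (cong (λ x → alternatingPoly n c t + x) top≡0) (+-identityʳ _)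
    where
    top≡0 : sgn (suc n) * ℕ→ℚ (c (suc n)) * (t ^ℚ suc n) ≡ 0ℚ
    top≡0 rewrite c₁₊ₙ≡0 = trans (cong (_* (t ^ℚ suc n)) (*-zeroʳ (sgn (suc n)))) (*-zeroˡ (t ^ℚ suc n))

open BinomialIdentities using (B-coeff; D-coeff; D-coeff-recurrence)
open AlternatingSums
open import Data.Nat using () renaming (_+_ to _+ℕ_; _*_ to _*ℕ_)
open import Data.Nat.Properties using (n<1+n; +-suc; +-comm)
open import Data.Nat.Combinatorics using (_C_; k>n⇒nCk≡0)
open import Data.Rational using (ℚ; _+_; _*_; _-_; -_)
open import Data.Rational.Solver using (module +-*-Solver)

N-D-recurrence : ∀ m t →
  ℕ→ℚ (3 +ℕ 2 *ℕ m) * N-D (2 +ℕ m) t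
  ≡ ℕ→ℚ m * N-B (2 +ℕ m) t + ℕ→ℚ (3 +ℕ m) * N-B (1 +ℕ m) t
    + ℕ→ℚ (3 +ℕ 2 *ℕ m) * (- t * N-B (1 +ℕ m) t)
N-D-recurrence m t = begin
  ℕ→ℚ d * alternatingPoly l (D-coeff l) t
    ≡⟨ alternatingPoly-* l d (D-coeff l) t ⟨
  alternatingPoly l (λ k → d *ℕ D-coeff l k) t
    ≡⟨ alternatingPoly-cong l t (D-coeff-recurrence m) ⟩
  alternatingPoly l (λ k → c₂ k +ℕ c₁ k +ℕ c₀ k) t
    ≡⟨ alternatingPoly-+ l (λ k → c₂ k +ℕ c₁ k) c₀ t ⟩
  alternatingPoly l (λ k → c₂ k +ℕ c₁ k) t + alternatingPoly l c₀ t
    ≡⟨ cong (_+ alternatingPoly l c₀ t) (alternatingPoly-+ l c₂ c₁ t) ⟩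
  alternatingPoly l c₂ t + alternatingPoly l c₁ t + alternatingPoly l c₀ t
    ≡⟨ cong₂ _+_ (cong₂ _+_ (alternatingPoly-* l m (B-coeff l) t)
                            (alternatingPoly-* l (3 +ℕ m) (B-coeff (1 +ℕ m)) t))
                 (alternatingPoly-* l d (shift (B-coeff (1 +ℕ m))) t) ⟩
  ℕ→ℚ m * N-B l t + ℕ→ℚ (3 +ℕ m) * alternatingPoly l (B-coeff (1 +ℕ m)) t
    + ℕ→ℚ d * alternatingPoly l (shift (B-coeff (1 +ℕ m))) t
    ≡⟨ cong₂ (λ x y → ℕ→ℚ m * N-B l t + ℕ→ℚ (3 +ℕ m) * x + ℕ→ℚ d * y)
             (alternatingPoly-drop-top (1 +ℕ m) (B-coeff (1 +ℕ m)) t B-top≡0)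
             (alternatingPoly-shift (1 +ℕ m) (B-coeff (1 +ℕ m)) t) ⟩
  ℕ→ℚ m * N-B l t + ℕ→ℚ (3 +ℕ m) * N-B (1 +ℕ m) t + ℕ→ℚ d * (- t * N-B (1 +ℕ m) t) ∎
  where
  open ≡-Reasoning
  l = 2 +ℕ m
  d = 3 +ℕ 2 *ℕ m
  c₂ c₁ c₀ : ℕ → ℕ
  c₂ k = m *ℕ B-coeff l k
  c₁ k = (3 +ℕ m) *ℕ B-coeff (1 +ℕ m) k
  c₀ k = d *ℕ shift (B-coeff (1 +ℕ m)) k
  B-top≡0 : B-coeff (1 +ℕ m) l ≡ 0
  B-top≡0 = cong (_*ℕ ((1 +ℕ m +ℕ l ∸ 1) C l)) (k>n⇒nCk≡0 (n<1+n (suc m)))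

ℕ→ℚ[2l-1]*over2l-1 : ∀ a m → ℕ→ℚ (3 +ℕ 2 *ℕ m) * over2l-1 a (2 +ℕ m) ≡ ℕ→ℚ a
ℕ→ℚ[2l-1]*over2l-1 a m =
  trans (cong (λ n → ℕ→ℚ n * over2l-1 a (2 +ℕ m)) 2l-1≡3+2m) (ℕ→ℚ-*-/ a (2 *ℕ (2 +ℕ m) ∸ 2))
  where
  2l-1≡3+2m : 3 +ℕ 2 *ℕ m ≡ suc (2 *ℕ (2 +ℕ m) ∸ 2)
  2l-1≡3+2m = cong suc (sym (trans (+-suc m (suc (m +ℕ 0))) (cong suc (+-suc m (m +ℕ 0)))))

mainTheorem9 : (l : ℕ) → 4 ≤ l → (t : ℚ) →
    N-D l t ≡ over2l-1 (l ∸ 2) l * N-B l t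
              + (over2l-1 (l +ℕ 1) l - t) * N-B (l ∸ 1) t
-- The explicit formulas satisfy the identity as soon as l ≥ 2.
mainTheorem9 zero          ()          t
mainTheorem9 (suc zero)    (s≤s ())    t
mainTheorem9 (suc (suc m)) _ t = ℕ→ℚ-suc-cancelˡ (2 +ℕ 2 *ℕ m) (begin
  δ * N-D l t
    ≡⟨ N-D-recurrence m t ⟩
  ℕ→ℚ m * Bₗ + ℕ→ℚ (3 +ℕ m) * Bₗ₋₁ + δ * (- t * Bₗ₋₁)
    ≡⟨ cong₂ (λ x y → x * Bₗ + y * Bₗ₋₁ + δ * (- t * Bₗ₋₁)) δα≡l-2 δβ≡l+1 ⟨
  (δ * α) * Bₗ + (δ * β) * Bₗ₋₁ + δ * (- t * Bₗ₋₁)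
    ≡⟨ solve 6 (λ δ α β t B B′ → (δ :* α) :* B :+ (δ :* β) :* B′ :+ δ :* (:- t :* B′)
                                 := δ :* (α :* B :+ (β :- t) :* B′)) refl δ α β t Bₗ Bₗ₋₁ ⟩
  δ * (α * Bₗ + (β - t) * Bₗ₋₁) ∎)
  where
  open ≡-Reasoning
  open +-*-Solver
  l = 2 +ℕ m
  δ = ℕ→ℚ (3 +ℕ 2 *ℕ m)
  α = over2l-1 m l
  β = over2l-1 (l +ℕ 1) l
  Bₗ = N-B l t
  Bₗ₋₁ = N-B (1 +ℕ m) t
  δα≡l-2 : δ * α ≡ ℕ→ℚ m
  δα≡l-2 = ℕ→ℚ[2l-1]*over2l-1 m m
  δβ≡l+1 : δ * β ≡ ℕ→ℚ (3 +ℕ m)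
  δβ≡l+1 = trans (ℕ→ℚ[2l-1]*over2l-1 (l +ℕ 1) m) (cong (λ n → ℕ→ℚ (suc (suc n))) (+-comm m 1))
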